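{- Let $n\geq 1$, $G\in D(n)$, and let $uv,xy\in\binom{[n]}{2}$. Then $G_{uv}\in D(n)$ and $G_{uv,xy}\in D(n)$.
   Context: A multigraph is $(V,w)$ with $w:\binom V2\to\mathbb{N}$; $\mu(G)=\max w$. An $(s,q)$-graph is one in which every $s$ vertices span total multiplicity at most $q$; $F(n,s,q)$ is the set of $(s,q)$-graphs on $[n]$. $D(n)=\{G\in F(n,4,15):\mu(G)\le 3\}\cap F(n,3,8)$. For $G=(V,w)$ and distinct $x,y\in V$, $G_{xy}=(V,w')$ is defined by $w'(xy)=1$, $w'(xu)=w(yu)$ for all $u\in V\setminus\{x,y\}$, and $w'(ab)=w(ab)$ for every pair $ab$ not containing $x$. For pairs $uv,xy$, $G_{uv,xy}=(G_{uv})_{xy}$. -}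

module Defs where

open import Data.Nat using (ℕ; _+_; _≤_)
open import Data.Fin using (Fin)
open import Data.Fin.Properties using (_≟_)
open import Data.Product using (_×_)
open import Relation.Binary.PropositionalEquality using (_≡_; _≢_)
open import Relation.Nullary using (yes; no)

-- Only values on pairs of distinct vertices are meaningful; it is required
-- to be symmetric on distinct pairs (so that it is a function on 2-subsets).
Multigraph : ℕ → Set
Multigraph n = Fin n → Fin n → ℕ

Symmetric : ∀ {n} → Multigraph n → Set
Symmetric {n} w = (a b : Fin n) → a ≢ b → w a b ≡ w b a

MaxMult≤ : ∀ {n} → ℕ → Multigraph n → Set
MaxMult≤ {n} m w = (a b : Fin n) → a ≢ b → w a b ≤ m

Is3Graph : ∀ {n} → ℕ → Multigraph n → Set
Is3Graph {n} q w = (a b c : Fin n) → a ≢ b → a ≢ c → b ≢ c →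
  w a b + w a c + w b c ≤ q

Is4Graph : ∀ {n} → ℕ → Multigraph n → Set
Is4Graph {n} q w = (a b c d : Fin n) →
  a ≢ b → a ≢ c → a ≢ d → b ≢ c → b ≢ d → c ≢ d →
  w a b + w a c + w a d + w b c + w b d + w c d ≤ q

-- D(n) = F(n,4,15) ∩ {μ ≤ 3} ∩ F(n,3,8)  (plus symmetry of the weight function)
InD : ∀ {n} → Multigraph n → Set
InD w = Symmetric w × Is4Graph 15 w × MaxMult≤ 3 w × Is3Graph 8 w

-- G_xy: w'(xy) = 1, w'(xu) = w(yu) for u ∉ {x,y}, other pairs unchanged.
-- Defined on ordered pairs symmetrically (value on the diagonal irrelevant).
op : ∀ {n} → Multigraph n → Fin n → Fin n → Multigraph n
op w x y a b with a ≟ x | b ≟ x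
... | yes _ | yes _ = w a b
... | yes _ | no _ with b ≟ y
...   | yes _ = 1
...   | no _  = w y b
op w x y a b | no _ | yes _ with a ≟ y
...   | yes _ = 1
...   | no _  = w y a
op w x y a b | no _ | no _ = w a b

op2 : ∀ {n} → Multigraph n → Fin n → Fin n → Fin n → Fin n → Multigraph n
op2 w u v x y = op (op w u v) x y

module Submission where

-- G_xy makes x a clone of y joined to y by a single edge.  A 2-, 3- or 4-set
-- avoiding x is untouched, and one containing x but not y has the same
-- multiplicity as its image under x ↦ y.  The only new sets contain both x
-- and y: {x,y,c} spans 1 + 2w(yc) ≤ 7, and {x,y,c,d} spans
-- 1 + 2(w(yc) + w(yd)) + w(cd) ≤ 1 + 6 + 8, using μ ≤ 3 and the (3,8)-bound
-- on {y,c,d}.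

open import Defs
open import Data.Empty using (⊥-elim)
open import Data.Fin using (Fin)
open import Data.Fin.Properties using (_≟_)
open import Data.Nat using (ℕ; _+_; _≤_; s≤s; z≤n)
open import Data.Nat.Properties using (≤-refl; ≤-trans; +-mono-≤; +-monoʳ-≤; n≤1+n; module ≤-Reasoning)
open import Data.Nat.Tactic.RingSolver using (solve-∀)
open import Data.Product using (_×_; _,_)
open import Relation.Binary.PropositionalEquality using (_≡_; _≢_; refl; sym; trans; subst; ≢-sym)
open import Relation.Nullary using (yes; no)

Σ3 : ∀ {n} → Multigraph n → Fin n → Fin n → Fin n → ℕ
Σ3 f a b c = f a b + f a c + f b c

Σ4 : ∀ {n} → Multigraph n → Fin n → Fin n → Fin n → Fin n → ℕ
Σ4 f a b c d = f a b + f a c + f a d + f b c + f b d + f c d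

Symmetric-focus : ∀ {n} {f : Multigraph n} x →
  (∀ a b → a ≢ b → a ≢ x → b ≢ x → f a b ≡ f b a) →
  (∀ b → b ≢ x → f x b ≡ f b x) →
  Symmetric f
Symmetric-focus x away at-x a b a≢b with a ≟ x | b ≟ x
... | yes refl | yes refl = ⊥-elim (a≢b refl)
... | yes refl | no b≢x   = at-x b b≢x
... | no a≢x   | yes refl = sym (at-x a a≢x)
... | no a≢x   | no b≢x   = away a b a≢b a≢x b≢x

module _ {n} {f : Multigraph n} (f-sym : Symmetric f) where

  Σ3-swap₁₂ : ∀ {a b c} → a ≢ b → Σ3 f a b c ≡ Σ3 f b a c
  Σ3-swap₁₂ {a} {b} {c} a≢b rewrite f-sym b a (≢-sym a≢b) = reorder (f a b) (f a c) (f b c)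
    where
    reorder : ∀ p q r → p + q + r ≡ p + r + q
    reorder = solve-∀

  Σ3-swap₂₃ : ∀ {a b c} → b ≢ c → Σ3 f a b c ≡ Σ3 f a c b
  Σ3-swap₂₃ {a} {b} {c} b≢c rewrite f-sym c b (≢-sym b≢c) = reorder (f a b) (f a c) (f b c)
    where
    reorder : ∀ p q r → p + q + r ≡ q + p + r
    reorder = solve-∀

  Σ4-swap₁₂ : ∀ {a b c d} → a ≢ b → Σ4 f a b c d ≡ Σ4 f b a c d
  Σ4-swap₁₂ {a} {b} {c} {d} a≢b rewrite f-sym b a (≢-sym a≢b) =
    reorder (f a b) (f a c) (f a d) (f b c) (f b d) (f c d)
    where
    reorder : ∀ p q r s t z → p + q + r + s + t + z ≡ p + s + t + q + r + z
    reorder = solve-∀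

  Σ4-swap₂₃ : ∀ {a b c d} → b ≢ c → Σ4 f a b c d ≡ Σ4 f a c b d
  Σ4-swap₂₃ {a} {b} {c} {d} b≢c rewrite f-sym c b (≢-sym b≢c) =
    reorder (f a b) (f a c) (f a d) (f b c) (f b d) (f c d)
    where
    reorder : ∀ p q r s t z → p + q + r + s + t + z ≡ q + p + r + s + z + t
    reorder = solve-∀

  Σ4-swap₃₄ : ∀ {a b c d} → c ≢ d → Σ4 f a b c d ≡ Σ4 f a b d c
  Σ4-swap₃₄ {a} {b} {c} {d} c≢d rewrite f-sym d c (≢-sym c≢d) =
    reorder (f a b) (f a c) (f a d) (f b c) (f b d) (f c d)
    where
    reorder : ∀ p q r s t z → p + q + r + s + t + z ≡ p + r + q + t + s + z
    reorder = solve-∀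

  MaxMult≤-focus : ∀ {m} x →
    (∀ a b → a ≢ b → a ≢ x → b ≢ x → f a b ≤ m) →
    (∀ b → b ≢ x → f x b ≤ m) →
    MaxMult≤ m f
  MaxMult≤-focus {m} x away at-x a b a≢b with a ≟ x | b ≟ x
  ... | yes refl | yes refl = ⊥-elim (a≢b refl)
  ... | yes refl | no b≢x   = at-x b b≢x
  ... | no a≢x   | yes refl = subst (_≤ m) (f-sym x a (≢-sym a≢x)) (at-x a a≢x)
  ... | no a≢x   | no b≢x   = away a b a≢b a≢x b≢x

  Is3Graph-focus : ∀ {q} x →
    (∀ a b c → a ≢ b → a ≢ c → b ≢ c → a ≢ x → b ≢ x → c ≢ x → Σ3 f a b c ≤ q) →
    (∀ b c → b ≢ c → b ≢ x → c ≢ x → Σ3 f x b c ≤ q) →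
    Is3Graph q f
  Is3Graph-focus {q} x away at-x a b c a≢b a≢c b≢c with a ≟ x | b ≟ x | c ≟ x
  ... | yes refl | _        | _        = at-x b c b≢c (≢-sym a≢b) (≢-sym a≢c)
  ... | no a≢x   | yes refl | _        =
    subst (_≤ q) (Σ3-swap₁₂ (≢-sym a≢b)) (at-x a c a≢c a≢x (≢-sym b≢c))
  ... | no a≢x   | no b≢x   | yes refl =
    subst (_≤ q) (trans (Σ3-swap₁₂ (≢-sym a≢c)) (Σ3-swap₂₃ (≢-sym b≢c))) (at-x a b a≢b a≢x b≢x)
  ... | no a≢x   | no b≢x   | no c≢x   = away a b c a≢b a≢c b≢c a≢x b≢x c≢x

  Is4Graph-focus : ∀ {q} x →
    (∀ a b c d → a ≢ b → a ≢ c → a ≢ d → b ≢ c → b ≢ d → c ≢ d →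
      a ≢ x → b ≢ x → c ≢ x → d ≢ x → Σ4 f a b c d ≤ q) →
    (∀ b c d → b ≢ c → b ≢ d → c ≢ d → b ≢ x → c ≢ x → d ≢ x → Σ4 f x b c d ≤ q) →
    Is4Graph q f
  Is4Graph-focus {q} x away at-x a b c d a≢b a≢c a≢d b≢c b≢d c≢d
    with a ≟ x | b ≟ x | c ≟ x | d ≟ x
  ... | yes refl | _        | _        | _        =
    at-x b c d b≢c b≢d c≢d (≢-sym a≢b) (≢-sym a≢c) (≢-sym a≢d)
  ... | no a≢x   | yes refl | _        | _        =
    subst (_≤ q) (Σ4-swap₁₂ (≢-sym a≢b))
      (at-x a c d a≢c a≢d c≢d a≢x (≢-sym b≢c) (≢-sym b≢d))
  ... | no a≢x   | no b≢x   | yes refl | _        =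
    subst (_≤ q) (trans (Σ4-swap₁₂ (≢-sym a≢c)) (Σ4-swap₂₃ (≢-sym b≢c)))
      (at-x a b d a≢b a≢d b≢d a≢x b≢x (≢-sym c≢d))
  ... | no a≢x   | no b≢x   | no c≢x   | yes refl =
    subst (_≤ q) (trans (Σ4-swap₁₂ (≢-sym a≢d)) (trans (Σ4-swap₂₃ (≢-sym b≢d)) (Σ4-swap₃₄ (≢-sym c≢d))))
      (at-x a b c a≢b a≢c b≢c a≢x b≢x c≢x)
  ... | no a≢x   | no b≢x   | no c≢x   | no d≢x   =
    away a b c d a≢b a≢c a≢d b≢c b≢d c≢d a≢x b≢x c≢x d≢x

  Is3Graph-focus₂ : ∀ {q} x y →
    (∀ a b c → a ≢ b → a ≢ c → b ≢ c → a ≢ x → b ≢ x → c ≢ x → Σ3 f a b c ≤ q) →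
    (∀ b c → b ≢ c → b ≢ x → c ≢ x → b ≢ y → c ≢ y → Σ3 f x b c ≤ q) →
    (∀ c → c ≢ x → c ≢ y → Σ3 f x y c ≤ q) →
    Is3Graph q f
  Is3Graph-focus₂ {q} x y away at-x at-xy = Is3Graph-focus x away at-x′
    where
    at-x′ : ∀ b c → b ≢ c → b ≢ x → c ≢ x → Σ3 f x b c ≤ q
    at-x′ b c b≢c b≢x c≢x with b ≟ y | c ≟ y
    ... | yes refl | _        = at-xy c c≢x (≢-sym b≢c)
    ... | no b≢y   | yes refl = subst (_≤ q) (Σ3-swap₂₃ (≢-sym b≢c)) (at-xy b b≢x b≢y)
    ... | no b≢y   | no c≢y   = at-x b c b≢c b≢x c≢x b≢y c≢y

  Is4Graph-focus₂ : ∀ {q} x y →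
    (∀ a b c d → a ≢ b → a ≢ c → a ≢ d → b ≢ c → b ≢ d → c ≢ d →
      a ≢ x → b ≢ x → c ≢ x → d ≢ x → Σ4 f a b c d ≤ q) →
    (∀ b c d → b ≢ c → b ≢ d → c ≢ d → b ≢ x → c ≢ x → d ≢ x →
      b ≢ y → c ≢ y → d ≢ y → Σ4 f x b c d ≤ q) →
    (∀ c d → c ≢ d → c ≢ x → d ≢ x → c ≢ y → d ≢ y → Σ4 f x y c d ≤ q) →
    Is4Graph q f
  Is4Graph-focus₂ {q} x y away at-x at-xy = Is4Graph-focus x away at-x′
    where
    at-x′ : ∀ b c d → b ≢ c → b ≢ d → c ≢ d → b ≢ x → c ≢ x → d ≢ x → Σ4 f x b c d ≤ q
    at-x′ b c d b≢c b≢d c≢d b≢x c≢x d≢x with b ≟ y | c ≟ y | d ≟ y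
    ... | yes refl | _        | _        = at-xy c d c≢d c≢x d≢x (≢-sym b≢c) (≢-sym b≢d)
    ... | no b≢y   | yes refl | _        =
      subst (_≤ q) (Σ4-swap₂₃ (≢-sym b≢c)) (at-xy b d b≢d b≢x d≢x b≢y (≢-sym c≢d))
    ... | no b≢y   | no c≢y   | yes refl =
      subst (_≤ q) (trans (Σ4-swap₂₃ (≢-sym b≢d)) (Σ4-swap₃₄ (≢-sym c≢d))) (at-xy b c b≢c b≢x c≢x b≢y c≢y)
    ... | no b≢y   | no c≢y   | no d≢y   = at-x b c d b≢c b≢d c≢d b≢x c≢x d≢x b≢y c≢y d≢y

module Clone {n} (w : Multigraph n) (x y : Fin n) (x≢y : x ≢ y) where

  op-away : ∀ {a b} → a ≢ x → b ≢ x → op w x y a b ≡ w a b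
  op-away {a} {b} a≢x b≢x with a ≟ x | b ≟ x
  ... | yes a≡x | _       = ⊥-elim (a≢x a≡x)
  ... | no _    | yes b≡x = ⊥-elim (b≢x b≡x)
  ... | no _    | no _    = refl

  op-row : ∀ {b} → b ≢ x → b ≢ y → op w x y x b ≡ w y b
  op-row {b} b≢x b≢y with x ≟ x | b ≟ x
  ... | no x≢x | _       = ⊥-elim (x≢x refl)
  ... | yes _  | yes b≡x = ⊥-elim (b≢x b≡x)
  ... | yes _  | no _ with b ≟ y
  ...   | yes b≡y = ⊥-elim (b≢y b≡y)
  ...   | no _    = refl

  op-col : ∀ {b} → b ≢ x → b ≢ y → op w x y b x ≡ w y b
  op-col {b} b≢x b≢y with b ≟ x | x ≟ x
  ... | yes b≡x | _      = ⊥-elim (b≢x b≡x)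
  ... | no _    | no x≢x = ⊥-elim (x≢x refl)
  ... | no _    | yes _ with b ≟ y
  ...   | yes b≡y = ⊥-elim (b≢y b≡y)
  ...   | no _    = refl

  op-xy : op w x y x y ≡ 1
  op-xy with x ≟ x | y ≟ x
  ... | no x≢x | _       = ⊥-elim (x≢x refl)
  ... | yes _  | yes y≡x = ⊥-elim (x≢y (sym y≡x))
  ... | yes _  | no _ with y ≟ y
  ...   | yes _   = refl
  ...   | no y≢y  = ⊥-elim (y≢y refl)

  op-yx : op w x y y x ≡ 1
  op-yx with y ≟ x | x ≟ x
  ... | yes y≡x | _      = ⊥-elim (x≢y (sym y≡x))
  ... | no _    | no x≢x = ⊥-elim (x≢x refl)
  ... | no _    | yes _ with y ≟ y
  ...   | yes _   = refl
  ...   | no y≢y  = ⊥-elim (y≢y refl)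

  op-row≡col : ∀ {b} → b ≢ x → op w x y x b ≡ op w x y b x
  op-row≡col {b} b≢x with b ≟ y
  ... | yes refl = trans op-xy (sym op-yx)
  ... | no b≢y   = trans (op-row b≢x b≢y) (sym (op-col b≢x b≢y))

  op-symmetric : Symmetric w → Symmetric (op w x y)
  op-symmetric w-sym = Symmetric-focus x
    (λ a b a≢b a≢x b≢x → trans (op-away a≢x b≢x) (trans (w-sym a b a≢b) (sym (op-away b≢x a≢x))))
    (λ _ → op-row≡col)

  op-MaxMult≤ : ∀ {m} → 1 ≤ m → Symmetric w → MaxMult≤ m w → MaxMult≤ m (op w x y)
  op-MaxMult≤ {m} 1≤m w-sym w≤m = MaxMult≤-focus (op-symmetric w-sym) x away at-x
    where
    away : ∀ a b → a ≢ b → a ≢ x → b ≢ x → op w x y a b ≤ m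
    away a b a≢b a≢x b≢x rewrite op-away a≢x b≢x = w≤m a b a≢b

    at-x : ∀ b → b ≢ x → op w x y x b ≤ m
    at-x b b≢x with b ≟ y
    ... | yes refl = subst (_≤ m) (sym op-xy) 1≤m
    ... | no b≢y   = subst (_≤ m) (sym (op-row b≢x b≢y)) (w≤m y b (≢-sym b≢y))

  op-Is3Graph : ∀ {m q} → 1 + (m + m) ≤ q →
    Symmetric w → MaxMult≤ m w → Is3Graph q w → Is3Graph q (op w x y)
  op-Is3Graph {q = q} 1+2m≤q w-sym w≤m w∈3 = Is3Graph-focus₂ (op-symmetric w-sym) x y away at-x at-xy
    where
    away : ∀ a b c → a ≢ b → a ≢ c → b ≢ c → a ≢ x → b ≢ x → c ≢ x → Σ3 (op w x y) a b c ≤ q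
    away a b c a≢b a≢c b≢c a≢x b≢x c≢x
      rewrite op-away a≢x b≢x | op-away a≢x c≢x | op-away b≢x c≢x = w∈3 a b c a≢b a≢c b≢c

    at-x : ∀ b c → b ≢ c → b ≢ x → c ≢ x → b ≢ y → c ≢ y → Σ3 (op w x y) x b c ≤ q
    at-x b c b≢c b≢x c≢x b≢y c≢y
      rewrite op-row b≢x b≢y | op-row c≢x c≢y | op-away b≢x c≢x = w∈3 y b c (≢-sym b≢y) (≢-sym c≢y) b≢c

    at-xy : ∀ c → c ≢ x → c ≢ y → Σ3 (op w x y) x y c ≤ q
    at-xy c c≢x c≢y rewrite op-xy | op-row c≢x c≢y | op-away (≢-sym x≢y) c≢x =
      ≤-trans (+-mono-≤ (+-monoʳ-≤ 1 (w≤m y c (≢-sym c≢y))) (w≤m y c (≢-sym c≢y))) 1+2m≤q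

  op-Is4Graph : ∀ {m q₃ q} → 1 + (m + m) + q₃ ≤ q →
    Symmetric w → MaxMult≤ m w → Is3Graph q₃ w → Is4Graph q w → Is4Graph q (op w x y)
  op-Is4Graph {m} {q₃} {q} 1+2m+q₃≤q w-sym w≤m w∈3 w∈4 =
    Is4Graph-focus₂ (op-symmetric w-sym) x y away at-x at-xy
    where
    away : ∀ a b c d → a ≢ b → a ≢ c → a ≢ d → b ≢ c → b ≢ d → c ≢ d →
      a ≢ x → b ≢ x → c ≢ x → d ≢ x → Σ4 (op w x y) a b c d ≤ q
    away a b c d a≢b a≢c a≢d b≢c b≢d c≢d a≢x b≢x c≢x d≢x
      rewrite op-away a≢x b≢x | op-away a≢x c≢x | op-away a≢x d≢x
            | op-away b≢x c≢x | op-away b≢x d≢x | op-away c≢x d≢x =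
      w∈4 a b c d a≢b a≢c a≢d b≢c b≢d c≢d

    at-x : ∀ b c d → b ≢ c → b ≢ d → c ≢ d → b ≢ x → c ≢ x → d ≢ x →
      b ≢ y → c ≢ y → d ≢ y → Σ4 (op w x y) x b c d ≤ q
    at-x b c d b≢c b≢d c≢d b≢x c≢x d≢x b≢y c≢y d≢y
      rewrite op-row b≢x b≢y | op-row c≢x c≢y | op-row d≢x d≢y
            | op-away b≢x c≢x | op-away b≢x d≢x | op-away c≢x d≢x =
      w∈4 y b c d (≢-sym b≢y) (≢-sym c≢y) (≢-sym d≢y) b≢c b≢d c≢d

    at-xy : ∀ c d → c ≢ d → c ≢ x → d ≢ x → c ≢ y → d ≢ y → Σ4 (op w x y) x y c d ≤ q
    at-xy c d c≢d c≢x d≢x c≢y d≢y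
      rewrite op-xy | op-row c≢x c≢y | op-row d≢x d≢y
            | op-away (≢-sym x≢y) c≢x | op-away (≢-sym x≢y) d≢x | op-away c≢x d≢x = begin
        1 + w y c + w y d + w y c + w y d + w c d   ≡⟨ regroup (w y c) (w y d) (w c d) ⟩
        1 + (w y c + w y d) + Σ3 w y c d            ≤⟨ +-mono-≤ (+-monoʳ-≤ 1 (+-mono-≤ y-c≤m y-d≤m)) y-c-d≤q₃ ⟩
        1 + (m + m) + q₃                            ≤⟨ 1+2m+q₃≤q ⟩
        q                                           ∎
      where
      open ≤-Reasoning
      y-c≤m : w y c ≤ m
      y-c≤m = w≤m y c (≢-sym c≢y)
      y-d≤m : w y d ≤ m
      y-d≤m = w≤m y d (≢-sym d≢y)
      y-c-d≤q₃ : Σ3 w y c d ≤ q₃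
      y-c-d≤q₃ = w∈3 y c d (≢-sym c≢y) (≢-sym d≢y) c≢d
      regroup : ∀ a b z → 1 + a + b + a + b + z ≡ 1 + (a + b) + (a + b + z)
      regroup = solve-∀

op-InD : ∀ {n} (w : Multigraph n) x y → x ≢ y → InD w → InD (op w x y)
op-InD w x y x≢y (w-sym , w∈4 , w≤3 , w∈3) =
    op-symmetric w-sym
  , op-Is4Graph ≤-refl w-sym w≤3 w∈3 w∈4
  , op-MaxMult≤ (s≤s z≤n) w-sym w≤3
  , op-Is3Graph (n≤1+n 7) w-sym w≤3 w∈3
  where open Clone w x y x≢y

lemma5p2 : (n : ℕ) → 1 ≤ n → (w : Multigraph n) → InD w →
    (u v x y : Fin n) → u ≢ v → x ≢ y →
    InD (op w u v) × InD (op2 w u v x y)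
lemma5p2 n _ w w∈D u v x y u≢v x≢y = w′∈D , op-InD (op w u v) x y x≢y w′∈D
  where
  w′∈D : InD (op w u v)
  w′∈D = op-InD w u v u≢v w∈D
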